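{- For all positive integers $m,n,k$, $$\mathcal{G}\left(T_{\{2m-1\}} \stackrel{k}{\cdot - \cdot} T_{\{2n-1\}}\right)=\mathcal{G}\left(T_{\{1\}} \stackrel{k}{\cdot - \cdot} T_{\{1\}}\right)=\mathcal{G}(P_{k+3}),$$ $$\mathcal{G}\left(T_{\{2m\}} \stackrel{k}{\cdot - \cdot} T_{\{2n-1\}}\right)=\mathcal{G}\left(T_{\{2\}} \stackrel{k}{\cdot - \cdot} T_{\{1\}}\right)=\mathcal{G}\left(T_{\{2\}} \stackrel{k+1}{\cdot - \cdot}\right),$$ and $$\mathcal{G}\left(T_{\{2m\}} \stackrel{k}{\cdot - \cdot} T_{\{2n\}}\right)=\mathcal{G}\left(T_{\{2\}} \stackrel{k}{\cdot - \cdot} T_{\{2\}}\right).$$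
   Context: Node-Kayles is the impartial game on a finite simple graph $G$ in which a move chooses a vertex $v$ and deletes its closed neighbourhood $N_G[v]$; the Grundy value is $\mathcal{G}(\emptyset)=0$, $\mathcal{G}(G)=\mathrm{mex}\{\mathcal{G}(G\setminus N_G[v]) : v\in V(G)\}$. $P_j$ is the path with $j$ vertices. For a positive integer $n$, $T_{\{n\}}$ is the star $K_{1,n}$ rooted at its center. For rooted graphs $G,H$ and $k\ge1$, $G \stackrel{k}{\cdot - \cdot} H$ is obtained from disjoint copies of $G$, $H$ and a path with $k+1$ vertices by identifying the root of $G$ with one endpoint of the path and the root of $H$ with the other. $T_{\{n\}} \stackrel{k}{\cdot - \cdot}$ (no second graph) denotes $T_{\{n\}}$ with its root identified with one endpoint of a path with $k+1$ vertices. -}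

module Defs where

open import Data.Nat using (ℕ; zero; suc; _+_; _*_; _≡ᵇ_)
open import Data.Bool using (Bool; true; false; if_then_else_; _∧_; _∨_; not)
open import Data.List using (List; []; _∷_; map; length; upTo; _++_)
open import Data.Bool.ListAction using (any)
open import Data.Product using (_×_; _,_)

-- A finite simple graph on vertex set {0, …, V-1}, given by an edge list.
-- Adjacency is symmetrised and loops are discarded, so the graph is simple.
record Graph : Set where
  constructor mkGraph
  field
    V : ℕ
    E : List (ℕ × ℕ)
open Graph public

isEdge : ℕ → ℕ → (ℕ × ℕ) → Bool
isEdge u v (a , b) = ((u ≡ᵇ a) ∧ (v ≡ᵇ b)) ∨ ((u ≡ᵇ b) ∧ (v ≡ᵇ a))

adj : Graph → ℕ → ℕ → Bool
adj G u v = not (u ≡ᵇ v) ∧ any (isEdge u v) (E G)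

inClosedNbhd : Graph → ℕ → ℕ → Bool
inClosedNbhd G u v = (u ≡ᵇ v) ∨ adj G u v

filterᵇ : {A : Set} → (A → Bool) → List A → List A
filterᵇ p [] = []
filterᵇ p (x ∷ xs) = if p x then x ∷ filterᵇ p xs else filterᵇ p xs

elem : ℕ → List ℕ → Bool
elem x l = any (λ y → x ≡ᵇ y) l

mexAux : ℕ → ℕ → List ℕ → ℕ
mexAux zero    i l = i
mexAux (suc f) i l = if elem i l then mexAux f (suc i) l else i

mex : List ℕ → ℕ
mex l = mexAux (length l) 0 l

-- Grundy value of Node-Kayles on the induced subgraph G[S], S a list of
-- (distinct) remaining vertices.  The fuel argument is only for termination:
-- every move removes at least the chosen vertex, so fuel = |S| suffices.
grundyFuel : Graph → ℕ → List ℕ → ℕ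
grundyFuel G zero    S = 0
grundyFuel G (suc f) S =
  mex (map (λ v → grundyFuel G f (filterᵇ (λ w → not (inClosedNbhd G v w)) S)) S)

grundy : Graph → ℕ
grundy G = grundyFuel G (V G) (upTo (V G))

pathEdges : ℕ → List (ℕ × ℕ)
pathEdges zero          = []
pathEdges (suc zero)    = []
pathEdges (suc (suc j)) = (j , suc j) ∷ pathEdges (suc j)

P : ℕ → Graph
P j = mkGraph j (pathEdges j)

-- T_{a} ·-k-· T_{b}: path vertices 0,…,k (k+1 vertices); vertex 0 is the
-- centre (root) of the star K_{1,a} with leaves k+1,…,k+a; vertex k is the
-- centre of K_{1,b} with leaves k+a+1,…,k+a+b.
doubleStar : ℕ → ℕ → ℕ → Graph
doubleStar a k b =
  mkGraph (suc k + a + b)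
    (pathEdges (suc k)
      ++ map (λ j → (0 , suc k + j)) (upTo a)
      ++ map (λ j → (k , suc k + a + j)) (upTo b))

-- T_{a} ·-k-·  (no second graph): star K_{1,a} rooted at its centre, with a
-- path on k+1 vertices attached at the root.
starPath : ℕ → ℕ → Graph
starPath a k =
  mkGraph (suc k + a)
    (pathEdges (suc k) ++ map (λ j → (0 , suc k + j)) (upTo a))

{-# OPTIONS --safe #-}
-- Three leaves l₁, l₂, l₃ hanging from a common vertex can be reduced to one without changing
-- the Grundy value: the options of the two positions match up, a move on l₁ or l₂ with the move
-- on l₃ and every other move with itself.  After a leaf has been played the other two leaves are
-- isolated, and two isolated vertices form the game *1 + *1 = 0, so they may be dropped as well.
-- Hence a star T_{a} with a ≥ 1 only matters through the parity of a.  Finally a star with a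
-- single leaf just prolongs the path: T_{1} ·-k-· T_{1} is P_{k+3} and T_{2} ·-k-· T_{1} is
-- T_{2} ·-(k+1)-· .
module Submission where

open import Defs
open import Function using (_∘_; _⇔_; mk⇔; Equivalence)
open Equivalence using (to; from)
open import Data.Bool using (Bool; true; false; T; not; _∧_; _∨_)
open import Data.Bool.Properties using (T-∨; T-∧; ∨-identityʳ; ∨-comm)
open import Data.Bool.ListAction using (any)
open import Data.Unit using (tt)
open import Data.List using (List; []; _∷_; _++_; map; length; upTo; filter)
open import Data.List.Properties using (map-cong; map-cong-local; map-∘; length-map; length-upTo; filter-notAll; ++-identityʳ)
open import Data.List.Membership.Propositional using (_∈_; _∉_)
open import Data.List.Membership.Propositional.Properties using (∈-filter⁺; ∈-filter⁻; ∈-map⁺; ∈-map⁻; ∈-upTo⁺; ∈-upTo⁻; ∈-++⁺ˡ; ∈-++⁺ʳ; ∈-++⁻)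
open import Data.List.Relation.Binary.Subset.Propositional using (_⊆_)
open import Data.List.Relation.Binary.Subset.Propositional.Properties using (map⁺)
open import Data.List.Relation.Unary.All using (tabulate)
open import Data.List.Relation.Unary.Any as Any using (here; there)
open import Data.List.Relation.Unary.Any.Properties using (any⁺; any⁻; Any-⊎⁺; Any-⊎⁻)
open import Data.Nat using (ℕ; zero; suc; _+_; _*_; _∸_; _≤_; _<_; _≡ᵇ_; z≤n; s≤s; _≤?_; _<?_)
open import Data.Nat.Properties
open import Data.Product using (_×_; _,_; ∃-syntax; proj₁; proj₂)
open import Data.Sum as Sum using (_⊎_; inj₁; inj₂; [_,_]′)
open import Relation.Binary.Definitions using (DecidableEquality; tri<; tri≈; tri>)
open import Relation.Nullary using (¬_; ¬?; yes; no; does; contradiction)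
open import Relation.Unary using (Decidable)
open import Relation.Nullary.Decidable using (T?; map′; dec-true; does-⇔)
open import Relation.Binary.PropositionalEquality

T-injective : ∀ {x y} → (T x → T y) → (T y → T x) → x ≡ y
T-injective {false} {false} _ _ = refl
T-injective {false} {true}  _ y⇒x = contradiction tt y⇒x
T-injective {true}  {false} x⇒y _ = contradiction tt x⇒y
T-injective {true}  {true}  _ _ = refl

map-⊆ : ∀ {A B : Set} {f : A → B} {xs ys} → (∀ {x} → x ∈ xs → f x ∈ ys) → map f xs ⊆ ys
map-⊆ {f = f} f∈ y∈ with ∈-map⁻ f y∈
... | _ , x∈ , refl = f∈ x∈

⊆-map : ∀ {A B : Set} {f : A → B} {xs ys} → (∀ {y} → y ∈ ys → ∃[ x ] x ∈ xs × y ≡ f x) → ys ⊆ map f xs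
⊆-map {f = f} onto y∈ with onto y∈
... | _ , x∈ , refl = ∈-map⁺ f x∈

filter-comm : ∀ {A : Set} {P Q : A → Set} (P? : Decidable P) (Q? : Decidable Q) xs →
              filter P? (filter Q? xs) ≡ filter Q? (filter P? xs)
filter-comm P? Q? []       = refl
filter-comm P? Q? (x ∷ xs) with does (Q? x) in qx | does (P? x) in px
... | true  | true  rewrite qx | px = cong (x ∷_) (filter-comm P? Q? xs)
... | true  | false rewrite px      = filter-comm P? Q? xs
... | false | true  rewrite qx      = filter-comm P? Q? xs
... | false | false                 = filter-comm P? Q? xs

-- Minimum excludant

∈⇒elem : ∀ {x l} → x ∈ l → T (elem x l)
∈⇒elem {x} x∈l = any⁺ _ (Any.map (λ { refl → ≡⇒≡ᵇ x x refl }) x∈l)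

elem⇒∈ : ∀ {x} l → T (elem x l) → x ∈ l
elem⇒∈ {x} l t = Any.map (≡ᵇ⇒≡ x _) (any⁻ _ l t)

mexAux-below : ∀ f i l → (∀ {j} → j < i → j ∈ l) → ∀ {j} → j < mexAux f i l → j ∈ l
mexAux-below zero    i l below = below
mexAux-below (suc f) i l below with elem i l in i∈l
... | false = below
... | true  = mexAux-below f (suc i) l below′
  where
  below′ : ∀ {j} → j < suc i → j ∈ l
  below′ j<1+i with m<1+n⇒m<n∨m≡n j<1+i
  ... | inj₁ j<i  = below j<i
  ... | inj₂ refl = elem⇒∈ l (subst T (sym i∈l) tt)

mexAux-∉ : ∀ f i l → mexAux f i l ∉ l ⊎ mexAux f i l ≡ f + i
mexAux-∉ zero    i l = inj₂ refl
mexAux-∉ (suc f) i l with elem i l in i∈l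
... | false = inj₁ (subst T i∈l ∘ ∈⇒elem)
... | true with mexAux-∉ f (suc i) l
...   | inj₁ ∉l = inj₁ ∉l
...   | inj₂ eq = inj₂ (trans eq (+-suc f i))

upTo-⊆⇒≤-length : ∀ n l → upTo n ⊆ l → n ≤ length l
upTo-⊆⇒≤-length zero    l _ = z≤n
upTo-⊆⇒≤-length (suc n) l ⊆l = ≤-<-trans n≤ shorter
  where
  ≢n? = λ w → ¬? (w ≟ n)
  n≤ : n ≤ length (filter ≢n? l)
  n≤ = upTo-⊆⇒≤-length n _ λ j∈ →
    ∈-filter⁺ ≢n? (⊆l (∈-upTo⁺ (m<n⇒m<1+n (∈-upTo⁻ j∈)))) (<⇒≢ (∈-upTo⁻ j∈))
  shorter : length (filter ≢n? l) < length l
  shorter = filter-notAll ≢n? l (Any.map (λ { refl n≢n → n≢n refl }) (⊆l (∈-upTo⁺ ≤-refl)))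

mex-below : ∀ l {j} → j < mex l → j ∈ l
mex-below l = mexAux-below (length l) 0 l (λ ())

-- mexAux gives up after length l steps, but by pigeonhole l cannot contain 0, …, length l.
mex-∉ : ∀ l → mex l ∉ l
mex-∉ l with mexAux-∉ (length l) 0 l
... | inj₁ ∉l = ∉l
... | inj₂ eq = λ mex∈l → 1+n≰n (upTo-⊆⇒≤-length (suc (length l)) l (covers mex∈l))
  where
  mex≡length : mex l ≡ length l
  mex≡length = trans eq (+-identityʳ (length l))
  covers : mex l ∈ l → upTo (suc (length l)) ⊆ l
  covers mex∈l j∈ with m<1+n⇒m<n∨m≡n (∈-upTo⁻ j∈)
  ... | inj₁ j<len = mex-below l (subst (_ <_) (sym mex≡length) j<len)
  ... | inj₂ refl  = subst (_∈ l) mex≡length mex∈l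

mex-unique : ∀ l {m} → (∀ {j} → j < m → j ∈ l) → m ∉ l → mex l ≡ m
mex-unique l {m} below m∉l with <-cmp (mex l) m
... | tri< lt _ _ = contradiction (below lt) (mex-∉ l)
... | tri≈ _ eq _ = eq
... | tri> _ _ gt = contradiction (mex-below l gt) m∉l

mex-extend : ∀ {l l′} → l ⊆ l′ → (∀ {x} → x ∈ l′ → x ∈ l ⊎ x ≢ mex l) → mex l′ ≡ mex l
mex-extend {l} {l′} l⊆l′ new =
  mex-unique l′ (l⊆l′ ∘ mex-below l) (λ m∈ → [ mex-∉ l , (λ m≢m → m≢m refl) ]′ (new m∈))

mex-cong : ∀ {l l′} → l ⊆ l′ → l′ ⊆ l → mex l′ ≡ mex l
mex-cong l⊆l′ l′⊆l = mex-extend l⊆l′ (inj₁ ∘ l′⊆l)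

-- Node-Kayles on a reflexive relation

module Game {A : Set} (N : A → A → Bool) (N-refl : ∀ x → T (N x x)) where

  play : A → List A → List A
  play v = filter (λ w → ¬? (T? (N v w)))

  gameFuel : ℕ → List A → ℕ
  gameFuel zero    S = 0
  gameFuel (suc f) S = mex (map (λ v → gameFuel f (play v S)) S)

  𝒢 : List A → ℕ
  𝒢 S = gameFuel (length S) S

  optionValues : List A → List ℕ
  optionValues S = map (λ v → 𝒢 (play v S)) S

  ∈-play⁺ : ∀ {v w S} → w ∈ S → ¬ T (N v w) → w ∈ play v S
  ∈-play⁺ {v} = ∈-filter⁺ (λ w → ¬? (T? (N v w)))

  ∈-play⁻ : ∀ {v w} S → w ∈ play v S → w ∈ S × ¬ T (N v w)
  ∈-play⁻ {v} S = ∈-filter⁻ (λ w → ¬? (T? (N v w))) {xs = S}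

  play-mono : ∀ v {S S′} → S ⊆ S′ → play v S ⊆ play v S′
  play-mono v {S} S⊆S′ w∈ = let w∈S , ¬vw = ∈-play⁻ S w∈ in ∈-play⁺ (S⊆S′ w∈S) ¬vw

  length-play : ∀ {v S} → v ∈ S → length (play v S) < length S
  length-play {v} {S} v∈S =
    filter-notAll (λ w → ¬? (T? (N v w))) S (Any.map (λ { refl ¬vv → ¬vv (N-refl v) }) v∈S)

  gameFuel-stable : ∀ {f f′} S → length S ≤ f → length S ≤ f′ → gameFuel f S ≡ gameFuel f′ S
  gameFuel-stable {zero}  {zero}  []      _ _ = refl
  gameFuel-stable {zero}  {suc _} []      _ _ = refl
  gameFuel-stable {suc _} {zero}  []      _ _ = refl
  gameFuel-stable {suc _} {suc _} []      _ _ = refl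
  gameFuel-stable {suc f} {suc f′} S@(_ ∷ _) (s≤s ≤f) (s≤s ≤f′) =
    cong mex (map-cong-local (tabulate λ v∈S → let shorter = ≤-pred (length-play v∈S) in
      gameFuel-stable (play _ S) (≤-trans shorter ≤f) (≤-trans shorter ≤f′)))

  𝒢-unfold : ∀ S → 𝒢 S ≡ mex (optionValues S)
  𝒢-unfold []          = refl
  𝒢-unfold S@(_ ∷ _) =
    cong mex (map-cong-local (tabulate λ v∈S → gameFuel-stable (play _ S) (≤-pred (length-play v∈S)) ≤-refl))

  gameFuel-cong : ∀ f {S S′} → S ⊆ S′ → S′ ⊆ S → gameFuel f S ≡ gameFuel f S′
  gameFuel-cong zero    _ _ = refl
  gameFuel-cong (suc f) {S} {S′} S⊆S′ S′⊆S =
    trans (cong mex (map-cong (λ v → gameFuel-cong f (play-mono v S⊆S′) (play-mono v S′⊆S)) S))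
          (sym (mex-cong (map⁺ _ S⊆S′) (map⁺ _ S′⊆S)))

  𝒢-cong : ∀ {S S′} → S ⊆ S′ → S′ ⊆ S → 𝒢 S ≡ 𝒢 S′
  𝒢-cong {S} {S′} S⊆S′ S′⊆S = begin
    𝒢 S             ≡⟨ gameFuel-stable S ≤-refl (m≤m+n _ _) ⟩
    gameFuel both S  ≡⟨ gameFuel-cong both S⊆S′ S′⊆S ⟩
    gameFuel both S′ ≡⟨ gameFuel-stable S′ (m≤n+m _ (length S)) ≤-refl ⟩
    𝒢 S′             ∎
    where
    open ≡-Reasoning
    both = length S + length S′

  option∈optionValues : ∀ {v S} → v ∈ S → 𝒢 (play v S) ∈ optionValues S
  option∈optionValues {S = S} = ∈-map⁺ (λ v → 𝒢 (play v S))

  𝒢≢option : ∀ {v S} → v ∈ S → 𝒢 S ≢ 𝒢 (play v S)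
  𝒢≢option {S = S} v∈S eq =
    mex-∉ (optionValues S) (subst (_∈ optionValues S) (trans (sym eq) (𝒢-unfold S)) (option∈optionValues v∈S))

  optionValues-⊆ : ∀ {S S′} → (∀ {v} → v ∈ S → ∃[ w ] w ∈ S′ × 𝒢 (play v S) ≡ 𝒢 (play w S′)) →
                   optionValues S ⊆ optionValues S′
  optionValues-⊆ {S} {S′} answer x∈ with ∈-map⁻ _ x∈
  ... | v , v∈S , refl with answer v∈S
  ...   | w , w∈S′ , eq = subst (_∈ optionValues S′) (sym eq) (option∈optionValues w∈S′)

  𝒢-extend : ∀ {S S′} → optionValues S′ ⊆ optionValues S →
             (∀ {v} → v ∈ S → 𝒢 (play v S) ∈ optionValues S′ ⊎ 𝒢 (play v S) ≢ 𝒢 S′) →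
             𝒢 S ≡ 𝒢 S′
  𝒢-extend {S} {S′} ⊆S new = trans (𝒢-unfold S) (trans (mex-extend ⊆S new′) (sym (𝒢-unfold S′)))
    where
    new′ : ∀ {x} → x ∈ optionValues S → x ∈ optionValues S′ ⊎ x ≢ mex (optionValues S′)
    new′ x∈ with ∈-map⁻ _ x∈
    ... | _ , v∈S , refl = Sum.map₂ (λ ≢𝒢 eq → ≢𝒢 (trans eq (sym (𝒢-unfold S′)))) (new v∈S)

  𝒢-cong-options : ∀ {S S′} → optionValues S ⊆ optionValues S′ → optionValues S′ ⊆ optionValues S →
                   𝒢 S ≡ 𝒢 S′
  𝒢-cong-options {S} {S′} ⊆′ ⊇′ =
    trans (𝒢-unfold S) (trans (sym (mex-cong ⊆′ ⊇′)) (sym (𝒢-unfold S′)))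

  module Pendants (_≟_ : DecidableEquality A) (N-sym : ∀ x y → N x y ≡ N y x) where

    infixl 5 _∖_

    _∖_ : List A → A → List A
    S ∖ l = filter (λ w → ¬? (w ≟ l)) S

    ∈-∖∖⁺ : ∀ {w l₁ l₂ S} → w ∈ S → w ≢ l₁ → w ≢ l₂ → w ∈ S ∖ l₁ ∖ l₂
    ∈-∖∖⁺ {l₁ = l₁} {l₂} w∈S w≢l₁ w≢l₂ =
      ∈-filter⁺ (λ w → ¬? (w ≟ l₂)) (∈-filter⁺ (λ w → ¬? (w ≟ l₁)) w∈S w≢l₁) w≢l₂

    ∈-∖∖⁻ : ∀ {w l₁ l₂} S → w ∈ S ∖ l₁ ∖ l₂ → w ∈ S × w ≢ l₁ × w ≢ l₂
    ∈-∖∖⁻ {l₁ = l₁} {l₂} S w∈ =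
      let w∈S∖l₁ , w≢l₂ = ∈-filter⁻ (λ w → ¬? (w ≟ l₂)) {xs = S ∖ l₁} w∈
          w∈S , w≢l₁ = ∈-filter⁻ (λ w → ¬? (w ≟ l₁)) {xs = S} w∈S∖l₁
      in w∈S , w≢l₁ , w≢l₂

    ∖-comm : ∀ S l l′ → S ∖ l ∖ l′ ≡ S ∖ l′ ∖ l
    ∖-comm S l l′ = filter-comm (λ w → ¬? (w ≟ l′)) (λ w → ¬? (w ≟ l)) S

    play-∖∖ : ∀ v S l₁ l₂ → play v (S ∖ l₁ ∖ l₂) ≡ play v S ∖ l₁ ∖ l₂
    play-∖∖ v S l₁ l₂ = begin
      play v (S ∖ l₁ ∖ l₂)  ≡⟨ filter-comm (λ w → ¬? (T? (N v w))) (≢? l₂) (S ∖ l₁) ⟩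
      play v (S ∖ l₁) ∖ l₂  ≡⟨ cong (_∖ l₂) (filter-comm (λ w → ¬? (T? (N v w))) (≢? l₁) S) ⟩
      play v S ∖ l₁ ∖ l₂    ∎
      where
      open ≡-Reasoning
      ≢? = λ l w → ¬? (w ≟ l)

    N-flip : ∀ {x y} → T (N x y) → T (N y x)
    N-flip {x} {y} = subst T (N-sym x y)

    record Isolated (S : List A) (l : A) : Set where
      field
        member : l ∈ S
        alone  : ∀ {w} → w ∈ S → T (N l w) → w ≡ l

    record Leaf (S : List A) (c l : A) : Set where
      field
        member   : l ∈ S
        ≢centre  : l ≢ c
        adjacent : T (N l c)
        pendant  : ∀ {w} → w ∈ S → T (N l w) → w ≡ l ⊎ w ≡ c

    Isolated-play : ∀ {S l v} → Isolated S l → v ∈ S → v ≢ l → Isolated (play v S) l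
    Isolated-play {S} I v∈S v≢l = record
      { member = ∈-play⁺ member (λ vl → v≢l (alone v∈S (N-flip vl)))
      ; alone  = alone ∘ proj₁ ∘ ∈-play⁻ S
      }
      where open Isolated I

    Leaf-∈-play : ∀ {S c l v} → Leaf S c l → v ∈ S → v ≢ l → v ≢ c → l ∈ play v S
    Leaf-∈-play L v∈S v≢l v≢c = ∈-play⁺ member (λ vl → [ v≢l , v≢c ]′ (pendant v∈S (N-flip vl)))
      where open Leaf L

    Leaf-play : ∀ {S c l v} → Leaf S c l → v ∈ S → v ≢ l → v ≢ c → Leaf (play v S) c l
    Leaf-play {S} L v∈S v≢l v≢c = record
      { member   = Leaf-∈-play L v∈S v≢l v≢c
      ; ≢centre  = ≢centre
      ; adjacent = adjacent
      ; pendant  = pendant ∘ proj₁ ∘ ∈-play⁻ S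
      }
      where open Leaf L

    Leaf-play-isolated : ∀ {S c l v} → Leaf S c l → v ∈ S → v ≢ l → v ≢ c → T (N v c) →
                         Isolated (play v S) l
    Leaf-play-isolated {S} {c} {l} {v} L v∈S v≢l v≢c vc = record
      { member = Leaf-∈-play L v∈S v≢l v≢c
      ; alone  = alone
      }
      where
      open Leaf L
      alone : ∀ {w} → w ∈ play v S → T (N l w) → w ≡ l
      alone w∈ lw with ∈-play⁻ S w∈
      ... | w∈S , ¬vw with pendant w∈S lw
      ...   | inj₁ w≡l  = w≡l
      ...   | inj₂ refl = contradiction vc ¬vw

    -- S ∖ l ∖ l′ is, up to order, the option of play l S in which l′ is played.
    𝒢-play-isolated-≢ : ∀ {S l l′} → l ≢ l′ → Isolated S l → Isolated S l′ →
                        𝒢 (play l S) ≢ 𝒢 (S ∖ l ∖ l′)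
    𝒢-play-isolated-≢ {S} {l} {l′} l≢l′ I I′ eq =
      𝒢≢option (Isolated.member (Isolated-play I′ (Isolated.member I) l≢l′)) (trans eq (𝒢-cong forth back))
      where
      forth : S ∖ l ∖ l′ ⊆ play l′ (play l S)
      forth x∈ = let x∈S , x≢l , x≢l′ = ∈-∖∖⁻ S x∈ in
        ∈-play⁺ (∈-play⁺ x∈S (x≢l ∘ Isolated.alone I x∈S)) (x≢l′ ∘ Isolated.alone I′ x∈S)
      back : play l′ (play l S) ⊆ S ∖ l ∖ l′
      back x∈ = let x∈lS , ¬l′x = ∈-play⁻ _ x∈ ; x∈S , ¬lx = ∈-play⁻ S x∈lS in
        ∈-∖∖⁺ x∈S (λ { refl → ¬lx (N-refl l) }) (λ { refl → ¬l′x (N-refl l′) })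

    𝒢-∖-isolated-pair : ∀ {S l₁ l₂} → l₁ ≢ l₂ → Isolated S l₁ → Isolated S l₂ →
                        𝒢 S ≡ 𝒢 (S ∖ l₁ ∖ l₂)
    𝒢-∖-isolated-pair {S} = go (length S) ≤-refl
      where
      go : ∀ n {S l₁ l₂} → length S ≤ n → l₁ ≢ l₂ → Isolated S l₁ → Isolated S l₂ →
           𝒢 S ≡ 𝒢 (S ∖ l₁ ∖ l₂)
      go zero    {[]} _ _ I₁ _ = contradiction (Isolated.member I₁) λ ()
      go (suc n) {S} {l₁} {l₂} len l₁≢l₂ I₁ I₂ = 𝒢-extend (optionValues-⊆ from-S⁻) from-S
        where
        S⁻ = S ∖ l₁ ∖ l₂

        unplayed : ∀ {v} → v ∈ S → v ≢ l₁ → v ≢ l₂ → 𝒢 (play v S) ≡ 𝒢 (play v S⁻)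
        unplayed v∈S v≢l₁ v≢l₂ =
          trans (go n (≤-pred (≤-trans (length-play v∈S) len)) l₁≢l₂
                    (Isolated-play I₁ v∈S v≢l₁) (Isolated-play I₂ v∈S v≢l₂))
                (cong 𝒢 (sym (play-∖∖ _ S l₁ l₂)))

        from-S⁻ : ∀ {w} → w ∈ S⁻ → ∃[ v ] v ∈ S × 𝒢 (play w S⁻) ≡ 𝒢 (play v S)
        from-S⁻ w∈S⁻ = let w∈S , w≢l₁ , w≢l₂ = ∈-∖∖⁻ S w∈S⁻ in
          _ , w∈S , sym (unplayed w∈S w≢l₁ w≢l₂)

        from-S : ∀ {v} → v ∈ S → 𝒢 (play v S) ∈ optionValues S⁻ ⊎ 𝒢 (play v S) ≢ 𝒢 S⁻
        from-S {v} v∈S with v ≟ l₁ | v ≟ l₂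
        ... | yes refl | _        = inj₂ (𝒢-play-isolated-≢ l₁≢l₂ I₁ I₂)
        ... | no _     | yes refl = inj₂ (subst (λ X → 𝒢 (play l₂ S) ≢ 𝒢 X) (∖-comm S l₂ l₁)
                                                (𝒢-play-isolated-≢ (≢-sym l₁≢l₂) I₂ I₁))
        ... | no v≢l₁  | no v≢l₂  = inj₁ (subst (_∈ optionValues S⁻) (sym (unplayed v∈S v≢l₁ v≢l₂))
                                                (option∈optionValues (∈-∖∖⁺ v∈S v≢l₁ v≢l₂)))

    -- After a leaf l is played, the leaves l′ and l₃ are isolated.
    𝒢-play-leaf : ∀ {S c l l′ l₃} → l ≢ l′ → l ≢ l₃ → l′ ≢ l₃ →
                  Leaf S c l → Leaf S c l′ → Leaf S c l₃ → 𝒢 (play l S) ≡ 𝒢 (play l₃ (S ∖ l ∖ l′))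
    𝒢-play-leaf {S} {c} {l} {l′} {l₃} l≢l′ l≢l₃ l′≢l₃ L L′ L₃ =
      trans (𝒢-∖-isolated-pair l′≢l₃ (isolated L′ l≢l′) (isolated L₃ l≢l₃)) (𝒢-cong forth back)
      where
      isolated : ∀ {l″} → Leaf S c l″ → l ≢ l″ → Isolated (play l S) l″
      isolated L″ l≢l″ = Leaf-play-isolated L″ (Leaf.member L) l≢l″ (Leaf.≢centre L) (Leaf.adjacent L)
      forth : play l S ∖ l′ ∖ l₃ ⊆ play l₃ (S ∖ l ∖ l′)
      forth x∈ with ∈-∖∖⁻ (play l S) x∈
      ... | x∈lS , x≢l′ , x≢l₃ with ∈-play⁻ S x∈lS
      ...   | x∈S , ¬lx = ∈-play⁺ (∈-∖∖⁺ x∈S (λ { refl → ¬lx (N-refl l) }) x≢l′)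
                                  ([ x≢l₃ , (λ { refl → ¬lx (Leaf.adjacent L) }) ]′ ∘ Leaf.pendant L₃ x∈S)
      back : play l₃ (S ∖ l ∖ l′) ⊆ play l S ∖ l′ ∖ l₃
      back x∈ with ∈-play⁻ _ x∈
      ... | x∈S⁻ , ¬l₃x with ∈-∖∖⁻ S x∈S⁻
      ...   | x∈S , x≢l , x≢l′ =
        ∈-∖∖⁺ (∈-play⁺ x∈S ([ x≢l , (λ { refl → ¬l₃x (Leaf.adjacent L₃) }) ]′ ∘ Leaf.pendant L x∈S))
              x≢l′ (λ { refl → ¬l₃x (N-refl l₃) })

    𝒢-play-centre : ∀ {S c l₁ l₂} → Leaf S c l₁ → Leaf S c l₂ →
                    𝒢 (play c S) ≡ 𝒢 (play c (S ∖ l₁ ∖ l₂))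
    𝒢-play-centre {S} {c} L₁ L₂ = 𝒢-cong
      (λ x∈ → let x∈S , ¬cx = ∈-play⁻ S x∈ in
        ∈-play⁺ (∈-∖∖⁺ x∈S (gone L₁ ¬cx) (gone L₂ ¬cx)) ¬cx)
      (play-mono c (proj₁ ∘ ∈-∖∖⁻ S))
      where
      gone : ∀ {l x} → Leaf S c l → ¬ T (N c x) → x ≢ l
      gone L ¬cx refl = ¬cx (N-flip (Leaf.adjacent L))

    𝒢-∖-leaf-pair : ∀ {S c l₁ l₂ l₃} → l₁ ≢ l₂ → l₁ ≢ l₃ → l₂ ≢ l₃ →
                    Leaf S c l₁ → Leaf S c l₂ → Leaf S c l₃ → 𝒢 S ≡ 𝒢 (S ∖ l₁ ∖ l₂)
    𝒢-∖-leaf-pair {S} = go (length S) ≤-refl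
      where
      go : ∀ n {S c l₁ l₂ l₃} → length S ≤ n → l₁ ≢ l₂ → l₁ ≢ l₃ → l₂ ≢ l₃ →
           Leaf S c l₁ → Leaf S c l₂ → Leaf S c l₃ → 𝒢 S ≡ 𝒢 (S ∖ l₁ ∖ l₂)
      go zero    {[]} _ _ _ _ L₁ _ _ = contradiction (Leaf.member L₁) λ ()
      go (suc n) {S} {c} {l₁} {l₂} {l₃} len l₁≢l₂ l₁≢l₃ l₂≢l₃ L₁ L₂ L₃ =
        𝒢-cong-options (optionValues-⊆ from-S) (optionValues-⊆ from-S⁻)
        where
        S⁻ = S ∖ l₁ ∖ l₂

        unplayed : ∀ {v} → v ∈ S → v ≢ l₁ → v ≢ l₂ → 𝒢 (play v S) ≡ 𝒢 (play v S⁻)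
        unplayed {v} v∈S v≢l₁ v≢l₂ with v ≟ c
        ... | yes refl = 𝒢-play-centre L₁ L₂
        ... | no v≢c with T? (N v c)
        ...   | yes vc = trans (𝒢-∖-isolated-pair l₁≢l₂ (Leaf-play-isolated L₁ v∈S v≢l₁ v≢c vc)
                                                      (Leaf-play-isolated L₂ v∈S v≢l₂ v≢c vc))
                               (cong 𝒢 (sym (play-∖∖ v S l₁ l₂)))
        ...   | no ¬vc = trans (go n (≤-pred (≤-trans (length-play v∈S) len)) l₁≢l₂ l₁≢l₃ l₂≢l₃
                                   (Leaf-play L₁ v∈S v≢l₁ v≢c) (Leaf-play L₂ v∈S v≢l₂ v≢c)
                                   (Leaf-play L₃ v∈S (λ { refl → ¬vc (Leaf.adjacent L₃) }) v≢c))
                               (cong 𝒢 (sym (play-∖∖ v S l₁ l₂)))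

        l₃∈S⁻ : l₃ ∈ S⁻
        l₃∈S⁻ = ∈-∖∖⁺ (Leaf.member L₃) (≢-sym l₁≢l₃) (≢-sym l₂≢l₃)

        from-S : ∀ {v} → v ∈ S → ∃[ w ] w ∈ S⁻ × 𝒢 (play v S) ≡ 𝒢 (play w S⁻)
        from-S {v} v∈S with v ≟ l₁ | v ≟ l₂
        ... | yes refl | _        = l₃ , l₃∈S⁻ , 𝒢-play-leaf l₁≢l₂ l₁≢l₃ l₂≢l₃ L₁ L₂ L₃
        ... | no _     | yes refl = l₃ , l₃∈S⁻ ,
          trans (𝒢-play-leaf (≢-sym l₁≢l₂) l₂≢l₃ l₁≢l₃ L₂ L₁ L₃)
                (cong (𝒢 ∘ play l₃) (∖-comm S l₂ l₁))
        ... | no v≢l₁  | no v≢l₂  = v , ∈-∖∖⁺ v∈S v≢l₁ v≢l₂ , unplayed v∈S v≢l₁ v≢l₂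

        from-S⁻ : ∀ {w} → w ∈ S⁻ → ∃[ v ] v ∈ S × 𝒢 (play w S⁻) ≡ 𝒢 (play v S)
        from-S⁻ w∈S⁻ = let w∈S , w≢l₁ , w≢l₂ = ∈-∖∖⁻ S w∈S⁻ in
          _ , w∈S , sym (unplayed w∈S w≢l₁ w≢l₂)

module Relabel {A B : Set} (N : A → A → Bool) (N-refl : ∀ x → T (N x x))
               (M : B → B → Bool) (M-refl : ∀ y → T (M y y)) (c : A → B) where
  private
    module GN = Game N N-refl
    module GM = Game M M-refl

  play-map : ∀ {x} X → (∀ {y} → y ∈ X → M (c x) (c y) ≡ N x y) → GM.play (c x) (map c X) ≡ map c (GN.play x X)
  play-map         []      _     = refl
  play-map {x} (y ∷ X) agree rewrite agree (here refl) with N x y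
  ... | true  = play-map X (agree ∘ there)
  ... | false = cong (c y ∷_) (play-map X (agree ∘ there))

  gameFuel-map : ∀ f X → (∀ {x y} → x ∈ X → y ∈ X → M (c x) (c y) ≡ N x y) →
                 GM.gameFuel f (map c X) ≡ GN.gameFuel f X
  gameFuel-map zero    X _     = refl
  gameFuel-map (suc f) X agree = cong mex (begin
    map (λ u → GM.gameFuel f (GM.play u (map c X))) (map c X)  ≡⟨ map-∘ X ⟨
    map (λ x → GM.gameFuel f (GM.play (c x) (map c X))) X      ≡⟨ map-cong-local (tabulate step) ⟩
    map (λ x → GN.gameFuel f (GN.play x X)) X                  ∎)
    where
    open ≡-Reasoning
    step : ∀ {x} → x ∈ X → GM.gameFuel f (GM.play (c x) (map c X)) ≡ GN.gameFuel f (GN.play x X)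
    step x∈X = trans (cong (GM.gameFuel f) (play-map X (agree x∈X)))
                     (gameFuel-map f _ λ y∈ z∈ → agree (proj₁ (GN.∈-play⁻ X y∈)) (proj₁ (GN.∈-play⁻ X z∈)))

  𝒢-relabel : ∀ {X Y} → (∀ {x y} → x ∈ X → y ∈ X → M (c x) (c y) ≡ N x y) →
              map c X ⊆ Y → Y ⊆ map c X → GM.𝒢 Y ≡ GN.𝒢 X
  𝒢-relabel {X} {Y} agree cX⊆Y Y⊆cX = begin
    GM.𝒢 Y                                  ≡⟨ GM.𝒢-cong Y⊆cX cX⊆Y ⟩
    GM.𝒢 (map c X)                          ≡⟨ GM.gameFuel-stable (map c X) ≤-refl (≤-reflexive (length-map c X)) ⟩
    GM.gameFuel (length X) (map c X)        ≡⟨ gameFuel-map (length X) X agree ⟩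
    GN.𝒢 X                                  ∎
    where open ≡-Reasoning

-- The double star on an abstract vertex type

data Vertex : Set where
  path leafˡ leafʳ : ℕ → Vertex

_≟ᵥ_ : DecidableEquality Vertex
path p  ≟ᵥ path q  = map′ (cong path)  (λ { refl → refl }) (p ≟ q)
leafˡ s ≟ᵥ leafˡ t = map′ (cong leafˡ) (λ { refl → refl }) (s ≟ t)
leafʳ s ≟ᵥ leafʳ t = map′ (cong leafʳ) (λ { refl → refl }) (s ≟ t)
path _  ≟ᵥ leafˡ _ = no λ ()
path _  ≟ᵥ leafʳ _ = no λ ()
leafˡ _ ≟ᵥ path _  = no λ ()
leafˡ _ ≟ᵥ leafʳ _ = no λ ()
leafʳ _ ≟ᵥ path _  = no λ ()
leafʳ _ ≟ᵥ leafˡ _ = no λ ()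

linked : ℕ → Vertex → Vertex → Bool
linked k (path p)  (path q)  = (suc p ≡ᵇ q) ∨ (suc q ≡ᵇ p)
linked k (path p)  (leafˡ _) = p ≡ᵇ 0
linked k (leafˡ _) (path q)  = q ≡ᵇ 0
linked k (path p)  (leafʳ _) = p ≡ᵇ k
linked k (leafʳ _) (path q)  = q ≡ᵇ k
linked k _         _         = false

nbhd : ℕ → Vertex → Vertex → Bool
nbhd k x y = does (x ≟ᵥ y) ∨ linked k x y

nbhd-refl : ∀ k x → T (nbhd k x x)
nbhd-refl k x = subst (λ e → T (e ∨ linked k x x)) (sym (dec-true (x ≟ᵥ x) refl)) tt

linked-sym : ∀ k x y → linked k x y ≡ linked k y x
linked-sym k (path p)  (path q)  = ∨-comm (suc p ≡ᵇ q) (suc q ≡ᵇ p)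
linked-sym k (path _)  (leafˡ _) = refl
linked-sym k (path _)  (leafʳ _) = refl
linked-sym k (leafˡ _) (path _)  = refl
linked-sym k (leafˡ _) (leafˡ _) = refl
linked-sym k (leafˡ _) (leafʳ _) = refl
linked-sym k (leafʳ _) (path _)  = refl
linked-sym k (leafʳ _) (leafˡ _) = refl
linked-sym k (leafʳ _) (leafʳ _) = refl

nbhd-sym : ∀ k x y → nbhd k x y ≡ nbhd k y x
nbhd-sym k x y = cong₂ _∨_ (does-⇔ (mk⇔ sym sym) (x ≟ᵥ y) (y ≟ᵥ x)) (linked-sym k x y)

module VertexGame (k : ℕ) = Game (nbhd k) (nbhd-refl k)

data Arc (k : ℕ) : Vertex → Vertex → Set where
  step  : ∀ {p} → Arc k (path p) (path (suc p))
  left  : ∀ {t} → Arc k (path 0) (leafˡ t)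
  right : ∀ {t} → Arc k (path k) (leafʳ t)

arc⇒linked : ∀ {k x y} → Arc k x y ⊎ Arc k y x → T (linked k x y)
arc⇒linked     (inj₁ (step {p})) = from T-∨ (inj₁ (≡⇒≡ᵇ (suc p) (suc p) refl))
arc⇒linked     (inj₁ left)       = tt
arc⇒linked {k} (inj₁ right)      = ≡⇒≡ᵇ k k refl
arc⇒linked     (inj₂ (step {p})) = from T-∨ (inj₂ (≡⇒≡ᵇ (suc p) (suc p) refl))
arc⇒linked     (inj₂ left)       = tt
arc⇒linked {k} (inj₂ right)      = ≡⇒≡ᵇ k k refl

linked⇒arc : ∀ {k} x y → T (linked k x y) → Arc k x y ⊎ Arc k y x
linked⇒arc (path p) (path q) h with to T-∨ h
... | inj₁ p+1≡q rewrite sym (≡ᵇ⇒≡ (suc p) q p+1≡q) = inj₁ step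
... | inj₂ q+1≡p rewrite sym (≡ᵇ⇒≡ (suc q) p q+1≡p) = inj₂ step
linked⇒arc     (path p)  (leafˡ _) h rewrite ≡ᵇ⇒≡ p 0 h = inj₁ left
linked⇒arc     (leafˡ _) (path q)  h rewrite ≡ᵇ⇒≡ q 0 h = inj₂ left
linked⇒arc {k} (path p)  (leafʳ _) h rewrite ≡ᵇ⇒≡ p k h = inj₁ right
linked⇒arc {k} (leafʳ _) (path q)  h rewrite ≡ᵇ⇒≡ q k h = inj₂ right

-- Transport to doubleStar

T-isEdge : ∀ {u v} e → T (isEdge u v e) → (u , v) ≡ e ⊎ (v , u) ≡ e
T-isEdge {u} {v} (a , b) h with to T-∨ h
... | inj₁ h₁ = let ua , vb = to T-∧ h₁ in inj₁ (cong₂ _,_ (≡ᵇ⇒≡ u a ua) (≡ᵇ⇒≡ v b vb))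
... | inj₂ h₂ = let ub , va = to T-∧ h₂ in inj₂ (cong₂ _,_ (≡ᵇ⇒≡ v a va) (≡ᵇ⇒≡ u b ub))

any-isEdge⇔ : ∀ {u v} es → T (any (isEdge u v) es) ⇔ ((u , v) ∈ es ⊎ (v , u) ∈ es)
any-isEdge⇔ {u} {v} es =
  mk⇔ (Any-⊎⁻ ∘ Any.map (T-isEdge _) ∘ any⁻ _ es) (any⁺ _ ∘ Any.map isEdge-∪ ∘ Any-⊎⁺)
  where
  isEdge-∪ : ∀ {e} → (u , v) ≡ e ⊎ (v , u) ≡ e → T (isEdge u v e)
  isEdge-∪ (inj₁ refl) = from T-∨ (inj₁ (from T-∧ (≡⇒≡ᵇ u u refl , ≡⇒≡ᵇ v v refl)))
  isEdge-∪ (inj₂ refl) =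
    from (T-∨ {(u ≡ᵇ v) ∧ (v ≡ᵇ u)}) (inj₂ (from T-∧ (≡⇒≡ᵇ u u refl , ≡⇒≡ᵇ v v refl)))

∈-pathEdges⁻ : ∀ n {e} → e ∈ pathEdges n → ∃[ i ] suc i < n × e ≡ (i , suc i)
∈-pathEdges⁻ (suc (suc n)) (here refl) = n , ≤-refl , refl
∈-pathEdges⁻ (suc (suc n)) (there e∈) =
  let i , i+1<n+1 , eq = ∈-pathEdges⁻ (suc n) e∈ in i , m<n⇒m<1+n i+1<n+1 , eq

∈-pathEdges⁺ : ∀ n {i} → suc i < n → (i , suc i) ∈ pathEdges n
∈-pathEdges⁺ (suc zero)      (s≤s ())
∈-pathEdges⁺ (suc n@(suc _)) i+1<n+1 =
  [ there ∘ ∈-pathEdges⁺ n , (λ { refl → here refl }) ]′ (m<1+n⇒m<n∨m≡n i+1<n+1)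

vertices : ℕ → ℕ → ℕ → List Vertex
vertices k a b = map path (upTo (suc k)) ++ map leafˡ (upTo a) ++ map leafʳ (upTo b)

IsVertex : ℕ → ℕ → ℕ → Vertex → Set
IsVertex k a b (path p)  = p ≤ k
IsVertex k a b (leafˡ t) = t < a
IsVertex k a b (leafʳ t) = t < b

∈-vertices⁺ : ∀ {k a b} x → IsVertex k a b x → x ∈ vertices k a b
∈-vertices⁺         (path p)  p≤k = ∈-++⁺ˡ (∈-map⁺ path (∈-upTo⁺ (s≤s p≤k)))
∈-vertices⁺ {k}     (leafˡ t) t<a = ∈-++⁺ʳ (map path (upTo (suc k))) (∈-++⁺ˡ (∈-map⁺ leafˡ (∈-upTo⁺ t<a)))
∈-vertices⁺ {k} {a} (leafʳ t) t<b =
  ∈-++⁺ʳ (map path (upTo (suc k))) (∈-++⁺ʳ (map leafˡ (upTo a)) (∈-map⁺ leafʳ (∈-upTo⁺ t<b)))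

∈-vertices⁻ : ∀ {k a b x} → x ∈ vertices k a b → IsVertex k a b x
∈-vertices⁻ {k} {a} x∈ with ∈-++⁻ (map path (upTo (suc k))) x∈
... | inj₁ x∈p with ∈-map⁻ path x∈p
...   | _ , p∈ , refl = ≤-pred (∈-upTo⁻ p∈)
∈-vertices⁻ {k} {a} x∈ | inj₂ x∈l with ∈-++⁻ (map leafˡ (upTo a)) x∈l
... | inj₁ x∈lˡ with ∈-map⁻ leafˡ x∈lˡ
...   | _ , t∈ , refl = ∈-upTo⁻ t∈
∈-vertices⁻ {k} {a} x∈ | inj₂ x∈l | inj₂ x∈lʳ with ∈-map⁻ leafʳ x∈lʳ
...   | _ , t∈ , refl = ∈-upTo⁻ t∈

encode : ℕ → ℕ → Vertex → ℕ
encode k a (path p)  = p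
encode k a (leafˡ t) = suc k + t
encode k a (leafʳ t) = suc k + a + t

decode : ℕ → ℕ → ℕ → Vertex
decode k a u with u ≤? k
... | yes _ = path u
... | no _ with u <? suc k + a
...   | yes _ = leafˡ (u ∸ suc k)
...   | no _  = leafʳ (u ∸ (suc k + a))

decode-encode : ∀ {k a b} x → IsVertex k a b x → decode k a (encode k a x) ≡ x
decode-encode {k} (path p) p≤k with p ≤? k
... | yes _   = refl
... | no p≰k = contradiction p≤k p≰k
decode-encode {k} {a} (leafˡ t) t<a with suc k + t ≤? k
... | yes k+1+t≤k = contradiction (≤-trans (m≤m+n (suc k) t) k+1+t≤k) 1+n≰n
... | no _ with suc k + t <? suc k + a
...   | yes _  = cong leafˡ (m+n∸m≡n (suc k) t)
...   | no ≮a = contradiction (+-monoʳ-< (suc k) t<a) ≮a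
decode-encode {k} {a} (leafʳ t) _ with suc k + a + t ≤? k
... | yes k+1+a+t≤k = contradiction (≤-trans (≤-trans (m≤m+n (suc k) a) (m≤m+n (suc k + a) t)) k+1+a+t≤k) 1+n≰n
... | no _ with suc k + a + t <? suc k + a
...   | yes <k+1+a = contradiction <k+1+a (≤⇒≯ (m≤m+n (suc k + a) t))
...   | no _       = cong leafʳ (m+n∸m≡n (suc k + a) t)

encode-decode : ∀ {k a b u} → u < suc k + a + b → IsVertex k a b (decode k a u) × encode k a (decode k a u) ≡ u
encode-decode {k} {a} {b} {u} u< with u ≤? k
... | yes u≤k = u≤k , refl
... | no u≰k with u <? suc k + a
...   | yes u<k+1+a = +-cancelˡ-< (suc k) _ a (subst (_< suc k + a) (sym u≡) u<k+1+a) , u≡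
  where u≡ = m+[n∸m]≡n (≰⇒> u≰k)
...   | no u≮k+1+a = +-cancelˡ-< (suc k + a) _ b (subst (_< suc k + a + b) (sym u≡) u<) , u≡
  where u≡ = m+[n∸m]≡n (≮⇒≥ u≮k+1+a)

encode-injective : ∀ {k a b} x y → IsVertex k a b x → IsVertex k a b y → encode k a x ≡ encode k a y → x ≡ y
encode-injective {k} {a} x y vx vy eq =
  trans (sym (decode-encode x vx)) (trans (cong (decode k a) eq) (decode-encode y vy))

encode-< : ∀ {k a b} x → IsVertex k a b x → encode k a x < suc k + a + b
encode-< {k} {a} {b} (path p)  p≤k = s≤s (≤-trans p≤k (≤-trans (m≤m+n k a) (m≤m+n (k + a) b)))
encode-< {k} {a} {b} (leafˡ t) t<a = <-≤-trans (+-monoʳ-< (suc k) t<a) (m≤m+n (suc k + a) b)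
encode-< {k} {a}     (leafʳ t) t<b = +-monoʳ-< (suc k + a) t<b

arc⇒edge : ∀ {k a b x y} → Arc k x y → IsVertex k a b y → (encode k a x , encode k a y) ∈ E (doubleStar a k b)
arc⇒edge {k}         step  p+1≤k = ∈-++⁺ˡ (∈-pathEdges⁺ (suc k) (s≤s p+1≤k))
arc⇒edge {k} {a}     left  t<a   =
  ∈-++⁺ʳ (pathEdges (suc k)) (∈-++⁺ˡ (∈-map⁺ (λ j → (0 , suc k + j)) (∈-upTo⁺ t<a)))
arc⇒edge {k} {a} {b} right t<b   =
  ∈-++⁺ʳ (pathEdges (suc k)) (∈-++⁺ʳ (map (λ j → (0 , suc k + j)) (upTo a))
                                     (∈-map⁺ (λ j → (k , suc k + a + j)) (∈-upTo⁺ t<b)))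

module _ {k a b : ℕ} {x y : Vertex} (vx : IsVertex k a b x) (vy : IsVertex k a b y) where

  private
    arc-at : ∀ x′ y′ → IsVertex k a b x′ → IsVertex k a b y′ →
             (encode k a x , encode k a y) ≡ (encode k a x′ , encode k a y′) → Arc k x′ y′ → Arc k x y
    arc-at x′ y′ vx′ vy′ eq = subst₂ (Arc k) (sym (encode-injective x x′ vx vx′ (cong proj₁ eq)))
                                             (sym (encode-injective y y′ vy vy′ (cong proj₂ eq)))

  edge⇒arc : (encode k a x , encode k a y) ∈ E (doubleStar a k b) → Arc k x y
  edge⇒arc e∈ with ∈-++⁻ (pathEdges (suc k)) e∈
  ... | inj₁ e∈path with ∈-pathEdges⁻ (suc k) e∈path
  ...   | i , s≤s i+1≤k , eq = arc-at (path i) (path (suc i)) (<⇒≤ i+1≤k) i+1≤k eq step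
  edge⇒arc e∈ | inj₂ e∈stars with ∈-++⁻ (map (λ j → (0 , suc k + j)) (upTo a)) e∈stars
  ... | inj₁ e∈left with ∈-map⁻ _ e∈left
  ...   | j , j∈ , eq = arc-at (path 0) (leafˡ j) z≤n (∈-upTo⁻ j∈) eq left
  edge⇒arc e∈ | inj₂ e∈stars | inj₂ e∈right with ∈-map⁻ _ e∈right
  ...   | j , j∈ , eq = arc-at (path k) (leafʳ j) ≤-refl (∈-upTo⁻ j∈) eq right

encode-≡ᵇ : ∀ {k a b x y} → IsVertex k a b x → IsVertex k a b y → (encode k a x ≡ᵇ encode k a y) ≡ does (x ≟ᵥ y)
encode-≡ᵇ {k} {a} {x = x} {y} vx vy =
  does-⇔ (mk⇔ (encode-injective x y vx vy) (cong (encode k a))) (encode k a x ≟ encode k a y) (x ≟ᵥ y)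

any-isEdge-encode : ∀ {k a b x y} → IsVertex k a b x → IsVertex k a b y →
                    any (isEdge (encode k a x) (encode k a y)) (E (doubleStar a k b)) ≡ linked k x y
any-isEdge-encode {x = x} {y} vx vy = T-injective
  (arc⇒linked ∘ Sum.map (edge⇒arc vx vy) (edge⇒arc vy vx) ∘ to (any-isEdge⇔ _))
  (from (any-isEdge⇔ _) ∘ Sum.map (λ arc → arc⇒edge arc vy) (λ arc → arc⇒edge arc vx) ∘ linked⇒arc x y)

inClosedNbhd-encode : ∀ {k a b x y} → IsVertex k a b x → IsVertex k a b y →
                      inClosedNbhd (doubleStar a k b) (encode k a x) (encode k a y) ≡ nbhd k x y
inClosedNbhd-encode {k} {a} {b} {x} {y} vx vy = begin
  (u ≡ᵇ v) ∨ (not (u ≡ᵇ v) ∧ any (isEdge u v) (E (doubleStar a k b)))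
    ≡⟨ cong₂ (λ e l → e ∨ (not e ∧ l)) (encode-≡ᵇ vx vy) (any-isEdge-encode vx vy) ⟩
  does (x ≟ᵥ y) ∨ (not (does (x ≟ᵥ y)) ∧ linked k x y)
    ≡⟨ ∨-not-∧ (does (x ≟ᵥ y)) _ ⟩
  nbhd k x y ∎
  where
  open ≡-Reasoning
  u = encode k a x
  v = encode k a y
  ∨-not-∧ : ∀ p q → p ∨ (not p ∧ q) ≡ p ∨ q
  ∨-not-∧ true  _ = refl
  ∨-not-∧ false _ = refl

inClosedNbhd-refl : ∀ G u → T (inClosedNbhd G u u)
inClosedNbhd-refl G u = from (T-∨ {u ≡ᵇ u}) (inj₁ (≡⇒≡ᵇ u u refl))

module GraphGame (G : Graph) = Game (inClosedNbhd G) (inClosedNbhd-refl G)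

filterᵇ-not : ∀ {A : Set} (p : A → Bool) xs → filterᵇ (λ x → not (p x)) xs ≡ filter (λ x → ¬? (T? (p x))) xs
filterᵇ-not p []       = refl
filterᵇ-not p (x ∷ xs) with p x
... | true  = filterᵇ-not p xs
... | false = cong (x ∷_) (filterᵇ-not p xs)

grundyFuel≡gameFuel : ∀ G f S → grundyFuel G f S ≡ GraphGame.gameFuel G f S
grundyFuel≡gameFuel G zero    S = refl
grundyFuel≡gameFuel G (suc f) S = cong mex (map-cong (λ v →
  trans (grundyFuel≡gameFuel G f _) (cong (GraphGame.gameFuel G f) (filterᵇ-not (inClosedNbhd G v) S))) S)

grundy≡𝒢 : ∀ G → grundy G ≡ GraphGame.𝒢 G (upTo (V G))
grundy≡𝒢 G = trans (grundyFuel≡gameFuel G (V G) (upTo (V G)))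
                   (GraphGame.gameFuel-stable G (upTo (V G)) (≤-reflexive (length-upTo (V G))) ≤-refl)

grundy-doubleStar : ∀ a k b → grundy (doubleStar a k b) ≡ VertexGame.𝒢 k (vertices k a b)
grundy-doubleStar a k b = trans (grundy≡𝒢 G) (Relabel.𝒢-relabel (nbhd k) (nbhd-refl k)
  (inClosedNbhd G) (inClosedNbhd-refl G) (encode k a)
  (λ x∈ y∈ → inClosedNbhd-encode (∈-vertices⁻ x∈) (∈-vertices⁻ y∈))
  (map-⊆ λ x∈ → ∈-upTo⁺ (encode-< _ (∈-vertices⁻ x∈)))
  (⊆-map λ u∈ → let vu , eq = encode-decode (∈-upTo⁻ u∈) in _ , ∈-vertices⁺ _ vu , sym eq))
  where G = doubleStar a k b

-- Reduction of the stars

𝒢ᵥ-relabel : ∀ {k a b k′ a′ b′} (σ : Vertex → Vertex) →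
             (∀ {x y} → IsVertex k a b x → IsVertex k a b y → nbhd k′ (σ x) (σ y) ≡ nbhd k x y) →
             (∀ {x} → IsVertex k a b x → IsVertex k′ a′ b′ (σ x)) →
             (∀ {y} → IsVertex k′ a′ b′ y → ∃[ x ] IsVertex k a b x × y ≡ σ x) →
             VertexGame.𝒢 k′ (vertices k′ a′ b′) ≡ VertexGame.𝒢 k (vertices k a b)
𝒢ᵥ-relabel {k} {k′ = k′} σ agree into onto =
  Relabel.𝒢-relabel (nbhd k) (nbhd-refl k) (nbhd k′) (nbhd-refl k′) σ
    (λ x∈ y∈ → agree (∈-vertices⁻ x∈) (∈-vertices⁻ y∈))
    (map-⊆ (∈-vertices⁺ _ ∘ into ∘ ∈-vertices⁻))
    (⊆-map λ y∈ → let x , vx , eq = onto (∈-vertices⁻ y∈) in x , ∈-vertices⁺ x vx , eq)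

≢⇒≡ᵇ-false : ∀ {m n} → m ≢ n → (m ≡ᵇ n) ≡ false
≢⇒≡ᵇ-false {m} {n} m≢n = T-injective (m≢n ∘ ≡ᵇ⇒≡ m n) λ ()

absorbʳ : ℕ → Vertex → Vertex
absorbʳ k (leafʳ _) = path (suc k)
absorbʳ k x         = x

𝒢-absorbʳ : ∀ k a → VertexGame.𝒢 (suc k) (vertices (suc k) a 0) ≡ VertexGame.𝒢 k (vertices k a 1)
𝒢-absorbʳ k a = 𝒢ᵥ-relabel (absorbʳ k) agree into onto
  where
  agree : ∀ {x y} → IsVertex k a 1 x → IsVertex k a 1 y → nbhd (suc k) (absorbʳ k x) (absorbʳ k y) ≡ nbhd k x y
  agree {path _}  {path _}  _         _         = refl
  agree {path _}  {leafˡ _} _         _         = refl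
  agree {path p}  {leafʳ _} p≤k       (s≤s z≤n) =
    trans (cong₂ (λ e f → e ∨ ((p ≡ᵇ k) ∨ f))
                 (≢⇒≡ᵇ-false (<⇒≢ (s≤s p≤k))) (≢⇒≡ᵇ-false (>⇒≢ (s≤s (m≤n⇒m≤1+n p≤k)))))
          (∨-identityʳ (p ≡ᵇ k))
  agree {leafˡ _} {path _}  _         _         = refl
  agree {leafˡ _} {leafˡ _} _         _         = refl
  agree {leafˡ _} {leafʳ _} _         (s≤s z≤n) = refl
  agree {leafʳ _} {path q}  (s≤s z≤n) q≤k       =
    cong₂ (λ e f → e ∨ (f ∨ (q ≡ᵇ k)))
          (≢⇒≡ᵇ-false (>⇒≢ (s≤s q≤k))) (≢⇒≡ᵇ-false (>⇒≢ (s≤s (m≤n⇒m≤1+n q≤k))))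
  agree {leafʳ _} {leafˡ _} (s≤s z≤n) _         = refl
  agree {leafʳ _} {leafʳ _} (s≤s z≤n) (s≤s z≤n) =
    T-injective (λ _ → nbhd-refl k (leafʳ 0)) (λ _ → nbhd-refl (suc k) (path (suc k)))
  into : ∀ {x} → IsVertex k a 1 x → IsVertex (suc k) a 0 (absorbʳ k x)
  into {path _}  p≤k = m≤n⇒m≤1+n p≤k
  into {leafˡ _} t<a = t<a
  into {leafʳ _} _   = ≤-refl
  onto : ∀ {y} → IsVertex (suc k) a 0 y → ∃[ x ] IsVertex k a 1 x × y ≡ absorbʳ k x
  onto {path p} p≤k+1 with m≤n⇒m<n∨m≡n p≤k+1
  ... | inj₁ p<k+1 = path p , ≤-pred p<k+1 , refl
  ... | inj₂ refl  = leafʳ 0 , s≤s z≤n , refl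
  onto {leafˡ t} t<a = leafˡ t , t<a , refl

absorbˡ : Vertex → Vertex
absorbˡ (path p)  = path (suc p)
absorbˡ (leafˡ _) = path 0
absorbˡ (leafʳ t) = leafʳ t

𝒢-absorbˡ : ∀ k b → VertexGame.𝒢 (suc k) (vertices (suc k) 0 b) ≡ VertexGame.𝒢 k (vertices k 1 b)
𝒢-absorbˡ k b = 𝒢ᵥ-relabel absorbˡ agree into onto
  where
  agree : ∀ {x y} → IsVertex k 1 b x → IsVertex k 1 b y → nbhd (suc k) (absorbˡ x) (absorbˡ y) ≡ nbhd k x y
  agree {path _}       {path _}       _         _         = refl
  agree {path zero}    {leafˡ _}      _         (s≤s z≤n) = refl
  agree {path (suc _)} {leafˡ _}      _         (s≤s z≤n) = refl
  agree {path _}       {leafʳ _}      _         _         = refl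
  agree {leafˡ _}      {path zero}    (s≤s z≤n) _         = refl
  agree {leafˡ _}      {path (suc _)} (s≤s z≤n) _         = refl
  agree {leafˡ _}      {leafˡ _}      (s≤s z≤n) (s≤s z≤n) = refl
  agree {leafˡ _}      {leafʳ _}      (s≤s z≤n) _         = refl
  agree {leafʳ _}      {path _}       _         _         = refl
  agree {leafʳ _}      {leafˡ _}      _         (s≤s z≤n) = refl
  agree {leafʳ _}      {leafʳ _}      _         _         = refl
  into : ∀ {x} → IsVertex k 1 b x → IsVertex (suc k) 0 b (absorbˡ x)
  into {path _}  p≤k = s≤s p≤k
  into {leafˡ _} _   = z≤n
  into {leafʳ _} t<b = t<b
  onto : ∀ {y} → IsVertex (suc k) 0 b y → ∃[ x ] IsVertex k 1 b x × y ≡ absorbˡ x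
  onto {path zero}    _         = leafˡ 0 , s≤s z≤n , refl
  onto {path (suc p)} (s≤s p≤k) = path p , p≤k , refl
  onto {leafʳ t}      t<b       = leafʳ t , t<b , refl

module VertexPendants (k : ℕ) = VertexGame.Pendants k _≟ᵥ_ (nbhd-sym k)

Leafˡ : ∀ {k a b t} → t < a → VertexPendants.Leaf k (vertices k a b) (path 0) (leafˡ t)
Leafˡ {k} {a} {b} {t} t<a = record
  { member   = ∈-vertices⁺ {k} {a} {b} (leafˡ t) t<a
  ; ≢centre  = λ ()
  ; adjacent = tt
  ; pendant  = λ _ → pendant _
  }
  where
  pendant : ∀ {k} w → T (nbhd k (leafˡ t) w) → w ≡ leafˡ t ⊎ w ≡ path 0
  pendant (path q)  h = inj₂ (cong path (≡ᵇ⇒≡ q 0 h))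
  pendant (leafˡ u) h = inj₁ (cong leafˡ (sym (≡ᵇ⇒≡ t u (subst T (∨-identityʳ _) h))))

Leafʳ : ∀ {k a b t} → t < b → VertexPendants.Leaf k (vertices k a b) (path k) (leafʳ t)
Leafʳ {k} {a} {b} {t} t<b = record
  { member   = ∈-vertices⁺ {k} {a} {b} (leafʳ t) t<b
  ; ≢centre  = λ ()
  ; adjacent = ≡⇒≡ᵇ k k refl
  ; pendant  = λ _ → pendant _
  }
  where
  pendant : ∀ w → T (nbhd k (leafʳ t) w) → w ≡ leafʳ t ⊎ w ≡ path k
  pendant (path q)  h = inj₂ (cong path (≡ᵇ⇒≡ q k h))
  pendant (leafʳ u) h = inj₁ (cong leafʳ (sym (≡ᵇ⇒≡ t u (subst T (∨-identityʳ _) h))))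

m<2+n⇒m<n : ∀ {m n} → m < 2 + n → m ≢ n → m ≢ suc n → m < n
m<2+n⇒m<n m<n+2 m≢n m≢n+1 with m<1+n⇒m<n∨m≡n m<n+2
... | inj₂ m≡n+1 = contradiction m≡n+1 m≢n+1
... | inj₁ m<n+1 with m<1+n⇒m<n∨m≡n m<n+1
...   | inj₁ m<n = m<n
...   | inj₂ m≡n = contradiction m≡n m≢n

𝒢-dropˡ : ∀ k i b → VertexGame.𝒢 k (vertices k (3 + i) b) ≡ VertexGame.𝒢 k (vertices k (suc i) b)
𝒢-dropˡ k i b = trans
  (𝒢-∖-leaf-pair (λ ()) (λ ()) (λ ()) (leaf (m<n⇒m<1+n (n<1+n (suc i)))) (leaf (n<1+n (2 + i))) (leaf (s≤s z≤n)))
  (𝒢-cong forth back)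
  where
  open VertexGame k
  open VertexPendants k
  leaf : ∀ {t} → t < 3 + i → Leaf (vertices k (3 + i) b) (path 0) (leafˡ t)
  leaf = Leafˡ
  forth : vertices k (3 + i) b ∖ leafˡ (suc i) ∖ leafˡ (2 + i) ⊆ vertices k (suc i) b
  forth x∈ with ∈-∖∖⁻ _ x∈
  ... | x∈S , x≢ , x≢′ = ∈-vertices⁺ {k} {suc i} {b} _ (shrink _ (∈-vertices⁻ x∈S) x≢ x≢′)
    where
    shrink : ∀ x → IsVertex k (3 + i) b x → x ≢ leafˡ (suc i) → x ≢ leafˡ (2 + i) → IsVertex k (suc i) b x
    shrink (path _)  p≤k _ _ = p≤k
    shrink (leafˡ t) t< ≢ ≢′ = m<2+n⇒m<n t< (≢ ∘ cong leafˡ) (≢′ ∘ cong leafˡ)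
    shrink (leafʳ _) t<b _ _ = t<b
  back : vertices k (suc i) b ⊆ vertices k (3 + i) b ∖ leafˡ (suc i) ∖ leafˡ (2 + i)
  back x∈ = ∈-∖∖⁺ {l₁ = leafˡ (suc i)} {leafˡ (2 + i)} (∈-vertices⁺ {k} {3 + i} {b} _ (grow _ vx))
                  (λ { refl → n≮n _ vx }) (λ { refl → n≮n _ (m<n⇒m<1+n vx) })
    where
    vx = ∈-vertices⁻ x∈
    grow : ∀ x → IsVertex k (suc i) b x → IsVertex k (3 + i) b x
    grow (path _)  p≤k = p≤k
    grow (leafˡ _) t<  = m<n⇒m<1+n (m<n⇒m<1+n t<)
    grow (leafʳ _) t<b = t<b

𝒢-dropʳ : ∀ k a i → VertexGame.𝒢 k (vertices k a (3 + i)) ≡ VertexGame.𝒢 k (vertices k a (suc i))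
𝒢-dropʳ k a i = trans
  (𝒢-∖-leaf-pair (λ ()) (λ ()) (λ ()) (leaf (m<n⇒m<1+n (n<1+n (suc i)))) (leaf (n<1+n (2 + i))) (leaf (s≤s z≤n)))
  (𝒢-cong forth back)
  where
  open VertexGame k
  open VertexPendants k
  leaf : ∀ {t} → t < 3 + i → Leaf (vertices k a (3 + i)) (path k) (leafʳ t)
  leaf = Leafʳ
  forth : vertices k a (3 + i) ∖ leafʳ (suc i) ∖ leafʳ (2 + i) ⊆ vertices k a (suc i)
  forth x∈ with ∈-∖∖⁻ _ x∈
  ... | x∈S , x≢ , x≢′ = ∈-vertices⁺ {k} {a} {suc i} _ (shrink _ (∈-vertices⁻ x∈S) x≢ x≢′)
    where
    shrink : ∀ x → IsVertex k a (3 + i) x → x ≢ leafʳ (suc i) → x ≢ leafʳ (2 + i) → IsVertex k a (suc i) x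
    shrink (path _)  p≤k _ _ = p≤k
    shrink (leafˡ _) t<a _ _ = t<a
    shrink (leafʳ t) t< ≢ ≢′ = m<2+n⇒m<n t< (≢ ∘ cong leafʳ) (≢′ ∘ cong leafʳ)
  back : vertices k a (suc i) ⊆ vertices k a (3 + i) ∖ leafʳ (suc i) ∖ leafʳ (2 + i)
  back x∈ = ∈-∖∖⁺ {l₁ = leafʳ (suc i)} {leafʳ (2 + i)} (∈-vertices⁺ {k} {a} {3 + i} _ (grow _ vx))
                  (λ { refl → n≮n _ vx }) (λ { refl → n≮n _ (m<n⇒m<1+n vx) })
    where
    vx = ∈-vertices⁻ x∈
    grow : ∀ x → IsVertex k a (suc i) x → IsVertex k a (3 + i) x
    grow (path _)  p≤k = p≤k
    grow (leafˡ _) t<a = t<a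
    grow (leafʳ _) t<  = m<n⇒m<1+n (m<n⇒m<1+n t<)

m+2*[1+n]≡2+[m+2*n] : ∀ m n → m + 2 * suc n ≡ 2 + (m + 2 * n)
m+2*[1+n]≡2+[m+2*n] m n = trans (cong (m +_) (*-suc 2 n)) (trans (+-suc m _) (cong suc (+-suc m _)))

𝒢-dropˡ* : ∀ k r s b → VertexGame.𝒢 k (vertices k (suc r + 2 * s) b) ≡ VertexGame.𝒢 k (vertices k (suc r) b)
𝒢-dropˡ* k r zero    b = cong (λ a → VertexGame.𝒢 k (vertices k (suc a) b)) (+-identityʳ r)
𝒢-dropˡ* k r (suc s) b = begin
  g (suc r + 2 * suc s)  ≡⟨ cong (g ∘ suc) (m+2*[1+n]≡2+[m+2*n] r s) ⟩
  g (3 + (r + 2 * s))    ≡⟨ 𝒢-dropˡ k (r + 2 * s) b ⟩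
  g (suc r + 2 * s)      ≡⟨ 𝒢-dropˡ* k r s b ⟩
  g (suc r)              ∎
  where
  open ≡-Reasoning
  g : ℕ → ℕ
  g a = VertexGame.𝒢 k (vertices k a b)

𝒢-dropʳ* : ∀ k a r s → VertexGame.𝒢 k (vertices k a (suc r + 2 * s)) ≡ VertexGame.𝒢 k (vertices k a (suc r))
𝒢-dropʳ* k a r zero    = cong (λ b → VertexGame.𝒢 k (vertices k a (suc b))) (+-identityʳ r)
𝒢-dropʳ* k a r (suc s) = begin
  g (suc r + 2 * suc s)  ≡⟨ cong (g ∘ suc) (m+2*[1+n]≡2+[m+2*n] r s) ⟩
  g (3 + (r + 2 * s))    ≡⟨ 𝒢-dropʳ k a (r + 2 * s) ⟩
  g (suc r + 2 * s)      ≡⟨ 𝒢-dropʳ* k a r s ⟩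
  g (suc r)              ∎
  where
  open ≡-Reasoning
  g : ℕ → ℕ
  g b = VertexGame.𝒢 k (vertices k a b)

grundy-doubleStar-parity : ∀ k r s r′ s′ →
  grundy (doubleStar (suc r + 2 * s) k (suc r′ + 2 * s′)) ≡ grundy (doubleStar (suc r) k (suc r′))
grundy-doubleStar-parity k r s r′ s′ = begin
  grundy (doubleStar (suc r + 2 * s) k (suc r′ + 2 * s′))          ≡⟨ grundy-doubleStar _ k _ ⟩
  VertexGame.𝒢 k (vertices k (suc r + 2 * s) (suc r′ + 2 * s′))  ≡⟨ 𝒢-dropˡ* k r s _ ⟩
  VertexGame.𝒢 k (vertices k (suc r) (suc r′ + 2 * s′))          ≡⟨ 𝒢-dropʳ* k (suc r) r′ s′ ⟩
  VertexGame.𝒢 k (vertices k (suc r) (suc r′))                    ≡⟨ grundy-doubleStar (suc r) k (suc r′) ⟨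
  grundy (doubleStar (suc r) k (suc r′))                          ∎
  where open ≡-Reasoning

P≡doubleStar : ∀ k → P (suc k) ≡ doubleStar 0 k 0
P≡doubleStar k = cong₂ mkGraph (sym (trans (+-identityʳ (suc k + 0)) (+-identityʳ (suc k))))
                               (sym (++-identityʳ (pathEdges (suc k))))

starPath≡doubleStar : ∀ a k → starPath a k ≡ doubleStar a k 0
starPath≡doubleStar a k = cong₂ mkGraph (sym (+-identityʳ (suc k + a)))
                                        (cong (pathEdges (suc k) ++_) (sym (++-identityʳ _)))

grundy-doubleStar-1-1≡P : ∀ k → grundy (doubleStar 1 k 1) ≡ grundy (P (3 + k))
grundy-doubleStar-1-1≡P k = begin
  grundy (doubleStar 1 k 1)                         ≡⟨ grundy-doubleStar 1 k 1 ⟩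
  VertexGame.𝒢 k (vertices k 1 1)                   ≡⟨ 𝒢-absorbʳ k 1 ⟨
  VertexGame.𝒢 (1 + k) (vertices (1 + k) 1 0)       ≡⟨ 𝒢-absorbˡ (1 + k) 0 ⟨
  VertexGame.𝒢 (2 + k) (vertices (2 + k) 0 0)       ≡⟨ grundy-doubleStar 0 (2 + k) 0 ⟨
  grundy (doubleStar 0 (2 + k) 0)                   ≡⟨ cong grundy (P≡doubleStar (2 + k)) ⟨
  grundy (P (3 + k))                                ∎
  where open ≡-Reasoning

grundy-doubleStar-2-1≡starPath : ∀ k → grundy (doubleStar 2 k 1) ≡ grundy (starPath 2 (1 + k))
grundy-doubleStar-2-1≡starPath k = begin
  grundy (doubleStar 2 k 1)                         ≡⟨ grundy-doubleStar 2 k 1 ⟩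
  VertexGame.𝒢 k (vertices k 2 1)                   ≡⟨ 𝒢-absorbʳ k 2 ⟨
  VertexGame.𝒢 (1 + k) (vertices (1 + k) 2 0)       ≡⟨ grundy-doubleStar 2 (1 + k) 0 ⟨
  grundy (doubleStar 2 (1 + k) 0)                   ≡⟨ cong grundy (starPath≡doubleStar 2 (1 + k)) ⟨
  grundy (starPath 2 (1 + k))                       ∎
  where open ≡-Reasoning

mainTheorem8 : (m n k : ℕ) → 1 ≤ m → 1 ≤ n → 1 ≤ k →
    ((grundy (doubleStar (2 * m ∸ 1) k (2 * n ∸ 1)) ≡ grundy (doubleStar 1 k 1))
      × (grundy (doubleStar 1 k 1) ≡ grundy (P (k + 3))))
    × ((grundy (doubleStar (2 * m) k (2 * n ∸ 1)) ≡ grundy (doubleStar 2 k 1))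
      × (grundy (doubleStar 2 k 1) ≡ grundy (starPath 2 (k + 1))))
    × (grundy (doubleStar (2 * m) k (2 * n)) ≡ grundy (doubleStar 2 k 2))
mainTheorem8 (suc m) (suc n) k _ _ _ =
    ( trans (cong₂ ds (odd m) (odd n)) (grundy-doubleStar-parity k 0 m 0 n)
    , trans (grundy-doubleStar-1-1≡P k) (cong (grundy ∘ P) (+-comm 3 k)) )
  , ( trans (cong₂ ds (even m) (odd n)) (grundy-doubleStar-parity k 1 m 0 n)
    , trans (grundy-doubleStar-2-1≡starPath k) (cong (grundy ∘ starPath 2) (+-comm 1 k)) )
  , trans (cong₂ ds (even m) (even n)) (grundy-doubleStar-parity k 1 m 1 n)
  where
  ds : ℕ → ℕ → ℕ
  ds a b = grundy (doubleStar a k b)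
  even : ∀ m → 2 * suc m ≡ 2 + 2 * m
  even = *-suc 2
  odd : ∀ m → 2 * suc m ∸ 1 ≡ 1 + 2 * m
  odd m = cong (_∸ 1) (even m)
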